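{- Let $a^{\nearrow}_n$ be the number of non-decreasing Dyck paths with air pockets of length $n$. Then $a^{\nearrow}_2=1$ and $a^{\nearrow}_n=2^{n-3}$ for all $n\geq3$.
   Context: A Dyck path with air pockets is a non-empty lattice path in the first quadrant starting at the origin, ending on the $x$-axis, with up-steps $U=(1,1)$ and down-steps $D_k=(1,-k)$, $k\ge1$, no two down-steps consecutive; its length is its number of steps. A valley is an occurrence of a factor $D_kU$ ($k\ge1$), and its height is the ordinate of the point between $D_k$ and $U$. A Dyck path with air pockets is non-decreasing if the heights of its valleys, read from left to right, form a non-decreasing sequence. -}

module Defs where

open import Data.Nat using (ℕ; zero; suc; _∸_; _≤_)
open import Data.List using (List; []; _∷_; length)
open import Data.List.Relation.Unary.All using (All)
open import Data.List.Relation.Unary.Linked using (Linked)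
open import Data.List.Relation.Unary.Unique.Propositional using (Unique)
open import Data.List.Membership.Propositional using (_∈_)
open import Data.Product using (Σ-syntax; _×_)
open import Data.Empty using (⊥)
open import Data.Unit using (⊤)
open import Relation.Binary.PropositionalEquality using (_≡_; _≢_)
open import Relation.Nullary using (¬_)
open import Function.Bundles using (_⇔_)

-- Steps: U = (1,1), D k = (1,-k); the condition k ≥ 1 is imposed in IsDPAP.
data Step : Set where
  U : Step
  D : ℕ → Step

data Walk : ℕ → List Step → ℕ → Set where
  done : ∀ {h} → Walk h [] h
  up   : ∀ {h s h'} → Walk (suc h) s h' → Walk h (U ∷ s) h'
  down : ∀ {h k s h'} → k ≤ h → Walk (h ∸ k) s h' → Walk h (D k ∷ s) h'

IsDown : Step → Set
IsDown U     = ⊥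
IsDown (D _) = ⊤

PositiveDown : Step → Set
PositiveDown U     = ⊤
PositiveDown (D k) = 1 ≤ k

NotBothDown : Step → Step → Set
NotBothDown a b = ¬ (IsDown a × IsDown b)

record IsDPAP (s : List Step) : Set where
  field
    nonEmpty     : s ≢ []
    downsPos     : All PositiveDown s
    walk         : Walk 0 s 0
    noDoubleDown : Linked NotBothDown s

-- Heights of valleys (factors D_k U), read left to right, starting from height h.
valleys : ℕ → List Step → List ℕ
valleys h []                = []
valleys h (U ∷ s)           = valleys (suc h) s
valleys h (D k ∷ [])        = []
valleys h (D k ∷ U ∷ s)     = (h ∸ k) ∷ valleys (suc (h ∸ k)) s
valleys h (D k ∷ D j ∷ s)   = valleys (h ∸ k) (D j ∷ s)

NonDecreasing : List ℕ → Set
NonDecreasing = Linked _≤_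

NDPath : ℕ → List Step → Set
NDPath n s = IsDPAP s × NonDecreasing (valleys 0 s) × length s ≡ n

HasCount : (List Step → Set) → ℕ → Set
HasCount P c = Σ[ xs ∈ List (List Step) ]
  (length xs ≡ c × Unique xs × (∀ s → P s ⇔ s ∈ xs))

-- Every down step except the last is followed by an up step and so closes a
-- valley, while the last one returns to the axis.  Hence, after the last valley
-- (at height v), a non-decreasing path at height h continues with U, or ends
-- with D h, or makes a valley D k U with 1 ≤ k ≤ h − v.  The number r i m of
-- such continuations of length m from height v + i + 1 does not depend on v and
-- satisfies r i 1 = 1, r i (m + 2) = r (i + 1) (m + 1) + (i + 1) · r 0 m, whence
-- r i (k + 3) = (i + 2) · 2^k.  A whole path is U followed by a continuation
-- from height 1 with v = 0, so there are r 0 (n − 1) of length n.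
module Submission where

open import Defs
open import Data.Nat using (ℕ; zero; suc; _+_; _*_; _≤_; _∸_; _^_; s≤s; z≤n)
open import Data.Nat.Properties
open import Data.Nat.Tactic.RingSolver using (solve-∀)
open import Data.Product using (_×_; _,_; Σ-syntax)
open import Data.Sum using (inj₁; inj₂)
open import Data.List using (List; []; _∷_; length; map; _++_)
open import Data.List.Properties using (length-++; length-map; ∷-injectiveʳ)
open import Data.List.Relation.Unary.All using (All; []; _∷_)
open import Data.List.Relation.Unary.Linked using (Linked; []; [-]; _∷_; tail)
open import Data.List.Relation.Unary.AllPairs using ([]; _∷_)
open import Data.List.Relation.Unary.Unique.Propositional using (Unique)
open import Data.List.Relation.Unary.Unique.Propositional.Properties using (map⁺; ++⁺)
open import Data.List.Relation.Unary.Any using (here)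
open import Data.List.Membership.Propositional using (_∈_)
open import Data.List.Membership.Propositional.Properties
  using (∈-map⁺; ∈-map⁻; ∈-++⁺ˡ; ∈-++⁺ʳ; ∈-++⁻)
open import Data.Empty using (⊥; ⊥-elim)
open import Data.Unit using (tt)
open import Relation.Binary.PropositionalEquality
open import Function using (_∘_)
open import Function.Bundles using (mk⇔)

linked-∷ : ∀ {A : Set} {R : A → A → Set} {x xs} →
           (∀ y → R x y) → Linked R xs → Linked R (x ∷ xs)
linked-∷ Rx []       = [-]
linked-∷ Rx [-]      = Rx _ ∷ [-]
linked-∷ Rx (r ∷ rs) = Rx _ ∷ r ∷ rs

notBothDown-U : ∀ y → NotBothDown U y
notBothDown-U y (() , _)

walk-[]⇒≡ : ∀ {h h'} → Walk h [] h' → h ≡ h'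
walk-[]⇒≡ done = refl

k≤a⇒v≤a+v∸k : ∀ a v {k} → k ≤ a → v ≤ a + v ∸ k
k≤a⇒v≤a+v∸k a v {k} k≤a =
  m+n≤o⇒m≤o∸n v (subst (_≤ a + v) (+-comm k v) (+-monoˡ-≤ v k≤a))

v≤a+v∸k⇒k≤a : ∀ a v {k} → k ≤ a + v → v ≤ a + v ∸ k → k ≤ a
v≤a+v∸k⇒k≤a a v {k} k≤a+v v≤ =
  +-cancelʳ-≤ v k a (subst (_≤ a + v) (+-comm v k) (m≤o∸n⇒m+n≤o v k≤a+v v≤))

-- A suffix, starting at height h, of a non-decreasing path right after one of
-- its valleys, of height v, or right after its first step (then v = 0).
Tail : ℕ → ℕ → List Step → Set
Tail v h s = All PositiveDown s × Walk h s 0 × Linked NotBothDown s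
           × NonDecreasing (v ∷ valleys h s)

valley : ℕ → List Step → List Step
valley k t = D k ∷ U ∷ t

mutual
  tails : ℕ → ℕ → ℕ → List (List Step)
  tails v i zero          = []
  tails v i (suc zero)    = (D (suc i + v) ∷ []) ∷ []
  tails v i (suc (suc m)) =
    map (U ∷_) (tails v (suc i) (suc m)) ++ valleyTails (suc i + v) (suc i) m

  valleyTails : ℕ → ℕ → ℕ → List (List Step)
  valleyTails h zero    m = []
  valleyTails h (suc j) m =
    map (valley (suc j)) (tails (h ∸ suc j) 0 m) ++ valleyTails h j m

tailCount : ℕ → ℕ → ℕ
tailCount i zero          = 0
tailCount i (suc zero)    = 1
tailCount i (suc (suc m)) = tailCount (suc i) (suc m) + suc i * tailCount 0 m

∈-valleyTails⁻ : ∀ h j m {s} → s ∈ valleyTails h j m →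
  Σ[ k ∈ ℕ ] Σ[ t ∈ List Step ]
    (1 ≤ k × k ≤ j × t ∈ tails (h ∸ k) 0 m × s ≡ valley k t)
∈-valleyTails⁻ h (suc j) m s∈
  with ∈-++⁻ (map (valley (suc j)) (tails (h ∸ suc j) 0 m)) s∈
... | inj₁ s∈map with ∈-map⁻ (valley (suc j)) s∈map
...   | t , t∈ , s≡ = suc j , t , s≤s z≤n , ≤-refl , t∈ , s≡
∈-valleyTails⁻ h (suc j) m s∈ | inj₂ s∈rest with ∈-valleyTails⁻ h j m s∈rest
... | k , t , 1≤k , k≤j , t∈ , s≡ = k , t , 1≤k , m≤n⇒m≤1+n k≤j , t∈ , s≡

∈-valleyTails⁺ : ∀ h j m {k t} → 1 ≤ k → k ≤ j → t ∈ tails (h ∸ k) 0 m →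
                 valley k t ∈ valleyTails h j m
∈-valleyTails⁺ h zero    m {zero} () z≤n _
∈-valleyTails⁺ h (suc j) m {k} 1≤k k≤1+j t∈ with m≤n⇒m<n∨m≡n k≤1+j
... | inj₂ refl    = ∈-++⁺ˡ (∈-map⁺ (valley (suc j)) t∈)
... | inj₁ (s≤s k≤j) =
  ∈-++⁺ʳ (map (valley (suc j)) (tails (h ∸ suc j) 0 m))
         (∈-valleyTails⁺ h j m 1≤k k≤j t∈)

tails-sound : ∀ v i m {s} → s ∈ tails v i m → Tail v (suc i + v) s × length s ≡ m
tails-sound v i (suc zero) (here refl) =
  ( s≤s z≤n ∷ []
  , down ≤-refl (subst (λ h → Walk h [] 0) (sym (n∸n≡0 (suc i + v))) done)
  , [-] , [-] ) , refl
tails-sound v i (suc (suc m)) s∈ with ∈-++⁻ (map (U ∷_) (tails v (suc i) (suc m))) s∈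
... | inj₁ s∈ups with ∈-map⁻ (U ∷_) s∈ups
...   | t , t∈ , refl with tails-sound v (suc i) (suc m) t∈
...     | (pos , w , nbd , nd) , len =
  (tt ∷ pos , up w , linked-∷ notBothDown-U nbd , nd) , cong suc len
tails-sound v i (suc (suc m)) s∈ | inj₂ s∈valleys
  with ∈-valleyTails⁻ (suc i + v) (suc i) m s∈valleys
... | k , t , 1≤k , k≤1+i , t∈ , refl with tails-sound (suc i + v ∸ k) 0 m t∈
...   | (pos , w , nbd , nd) , len =
  ( 1≤k ∷ tt ∷ pos
  , down (≤-trans k≤1+i (m≤m+n (suc i) v)) (up w)
  , (λ { (_ , ()) }) ∷ linked-∷ notBothDown-U nbd
  , k≤a⇒v≤a+v∸k (suc i) v k≤1+i ∷ nd ) , cong (suc ∘ suc) len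

tails-complete : ∀ v i s → Tail v (suc i + v) s → s ∈ tails v i (length s)
tails-complete v i (U ∷ s@(_ ∷ _)) (_ ∷ pos , up w , nbd , nd) =
  ∈-++⁺ˡ (∈-map⁺ (U ∷_) (tails-complete v (suc i) s (pos , w , tail nbd , nd)))
tails-complete v i (D k ∷ []) (_ , down k≤h w , _)
  with ≤-antisym k≤h (m∸n≡0⇒m≤n (walk-[]⇒≡ w))
... | refl = here refl
tails-complete v i (D k ∷ D j ∷ s) (_ , _ , notBoth ∷ _ , _) = ⊥-elim (notBoth (tt , tt))
tails-complete v i (D k ∷ U ∷ s)
               (1≤k ∷ _ ∷ pos , down k≤h (up w) , _ ∷ nbd , v≤ ∷ nd) =
  ∈-++⁺ʳ (map (U ∷_) (tails v (suc i) (suc (length s))))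
    (∈-valleyTails⁺ (suc i + v) (suc i) (length s) 1≤k
       (v≤a+v∸k⇒k≤a (suc i) v k≤h v≤)
       (tails-complete (suc i + v ∸ k) 0 s (pos , w , tail nbd , nd)))

mutual
  tails-unique : ∀ v i m → Unique (tails v i m)
  tails-unique v i zero          = []
  tails-unique v i (suc zero)    = [] ∷ []
  tails-unique v i (suc (suc m)) =
    ++⁺ (map⁺ ∷-injectiveʳ (tails-unique v (suc i) (suc m)))
        (valleyTails-unique (suc i + v) (suc i) m) disjoint
    where
    disjoint : ∀ {s} → s ∈ map (U ∷_) (tails v (suc i) (suc m))
                     × s ∈ valleyTails (suc i + v) (suc i) m → ⊥
    disjoint (s∈ups , s∈valleys)
      with ∈-map⁻ (U ∷_) s∈ups | ∈-valleyTails⁻ (suc i + v) (suc i) m s∈valleys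
    ... | _ , _ , refl | _ , _ , _ , _ , _ , ()

  valleyTails-unique : ∀ h j m → Unique (valleyTails h j m)
  valleyTails-unique h zero    m = []
  valleyTails-unique h (suc j) m =
    ++⁺ (map⁺ (∷-injectiveʳ ∘ ∷-injectiveʳ) (tails-unique (h ∸ suc j) 0 m))
        (valleyTails-unique h j m) disjoint
    where
    disjoint : ∀ {s} → s ∈ map (valley (suc j)) (tails (h ∸ suc j) 0 m)
                     × s ∈ valleyTails h j m → ⊥
    disjoint (s∈first , s∈rest)
      with ∈-map⁻ (valley (suc j)) s∈first | ∈-valleyTails⁻ h j m s∈rest
    ... | _ , _ , refl | _ , _ , _ , k≤j , _ , refl = <⇒≱ (s≤s k≤j) ≤-refl

mutual
  length-tails : ∀ v i m → length (tails v i m) ≡ tailCount i m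
  length-tails v i zero          = refl
  length-tails v i (suc zero)    = refl
  length-tails v i (suc (suc m)) = begin
    length (map (U ∷_) ups ++ valleyTails (suc i + v) (suc i) m)
      ≡⟨ length-++ (map (U ∷_) ups) ⟩
    length (map (U ∷_) ups) + length (valleyTails (suc i + v) (suc i) m)
      ≡⟨ cong₂ _+_ (trans (length-map (U ∷_) ups) (length-tails v (suc i) (suc m)))
                   (length-valleyTails (suc i + v) (suc i) m) ⟩
    tailCount (suc i) (suc m) + suc i * tailCount 0 m ∎
    where
    open ≡-Reasoning
    ups = tails v (suc i) (suc m)

  length-valleyTails : ∀ h j m → length (valleyTails h j m) ≡ j * tailCount 0 m
  length-valleyTails h zero    m = refl
  length-valleyTails h (suc j) m = begin
    length (map (valley (suc j)) first ++ valleyTails h j m)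
      ≡⟨ length-++ (map (valley (suc j)) first) ⟩
    length (map (valley (suc j)) first) + length (valleyTails h j m)
      ≡⟨ cong₂ _+_ (trans (length-map (valley (suc j)) first)
                          (length-tails (h ∸ suc j) 0 m))
                   (length-valleyTails h j m) ⟩
    tailCount 0 m + j * tailCount 0 m ∎
    where
    open ≡-Reasoning
    first = tails (h ∸ suc j) 0 m

+-distrib-doubling : ∀ i x → (3 + i) * x + (1 + i) * x ≡ (2 + i) * (2 * x)
+-distrib-doubling = solve-∀

tailCount-2 : ∀ i → tailCount i 2 ≡ 1
tailCount-2 i = cong (1 +_) (*-zeroʳ (suc i))

mutual
  tailCount-3+ : ∀ i k → tailCount i (3 + k) ≡ (2 + i) * 2 ^ k
  tailCount-3+ i zero = begin
    tailCount (suc i) 2 + suc i * 1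
      ≡⟨ cong₂ _+_ (tailCount-2 (suc i)) (*-identityʳ (suc i)) ⟩
    2 + i
      ≡⟨ sym (*-identityʳ (2 + i)) ⟩
    (2 + i) * 1 ∎
    where open ≡-Reasoning
  tailCount-3+ i (suc k) = begin
    tailCount (suc i) (3 + k) + suc i * tailCount 0 (2 + k)
      ≡⟨ cong₂ _+_ (tailCount-3+ (suc i) k) (cong (suc i *_) (tailCount-0-2+ k)) ⟩
    (3 + i) * 2 ^ k + (1 + i) * 2 ^ k
      ≡⟨ +-distrib-doubling i (2 ^ k) ⟩
    (2 + i) * (2 * 2 ^ k) ∎
    where open ≡-Reasoning

  tailCount-0-2+ : ∀ k → tailCount 0 (2 + k) ≡ 2 ^ k
  tailCount-0-2+ zero    = tailCount-2 0
  tailCount-0-2+ (suc k) = tailCount-3+ 0 k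

paths : ℕ → List (List Step)
paths m = map (U ∷_) (tails 0 0 m)

NDPath⇒∈paths : ∀ m s → NDPath (suc m) s → s ∈ paths m
NDPath⇒∈paths m [] (path , _) = ⊥-elim (IsDPAP.nonEmpty path refl)
NDPath⇒∈paths m (D k ∷ s) (path , _) with IsDPAP.downsPos path | IsDPAP.walk path
... | 1≤k ∷ _ | down k≤0 _ = ⊥-elim (<⇒≱ 1≤k k≤0)
NDPath⇒∈paths m (U ∷ s) (path , nd , len) with IsDPAP.downsPos path | IsDPAP.walk path
... | _ ∷ pos | up w =
  ∈-map⁺ (U ∷_) (subst (λ n → s ∈ tails 0 0 n) (suc-injective len)
    (tails-complete 0 0 s
       (pos , w , tail (IsDPAP.noDoubleDown path) , linked-∷ (λ _ → z≤n) nd)))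

∈paths⇒NDPath : ∀ m s → s ∈ paths m → NDPath (suc m) s
∈paths⇒NDPath m s s∈ with ∈-map⁻ (U ∷_) s∈
... | t , t∈ , refl with tails-sound 0 0 m t∈
... | (pos , w , nbd , nd) , len =
  record { nonEmpty = λ () ; downsPos = tt ∷ pos ; walk = up w
         ; noDoubleDown = linked-∷ notBothDown-U nbd }
  , tail nd , cong suc len

NDPath-count : ∀ m → HasCount (NDPath (suc m)) (tailCount 0 m)
NDPath-count m =
  paths m , trans (length-map (U ∷_) (tails 0 0 m)) (length-tails 0 0 m)
  , map⁺ ∷-injectiveʳ (tails-unique 0 0 m)
  , λ s → mk⇔ (NDPath⇒∈paths m s) (∈paths⇒NDPath m s)

theorem8 : HasCount (NDPath 2) 1 × (∀ n → 3 ≤ n → HasCount (NDPath n) (2 ^ (n ∸ 3)))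
theorem8 = NDPath-count 1 , λ where
  (suc (suc (suc k))) (s≤s (s≤s (s≤s _))) →
    subst (HasCount (NDPath (3 + k))) (tailCount-0-2+ k) (NDPath-count (2 + k))
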